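{- Let $\eta\in\{0,1\}$ and let $P,Q$ satisfy $\vdash_\eta P$ and $\vdash_\eta Q$. If $P\approx_a Q$ (ordinary asynchronous bisimilarity), then $P\approx_s^\eta Q$ (sequential bisimilarity at $\eta$).
   Context: Asynchronous $\pi$-calculus: processes $P ::= a\langle\tilde b\rangle \mid\ !a(\tilde b).P \mid P|Q \mid (\nu a)P \mid G$, $G ::= \mathbf 0 \mid a(\tilde b).P \mid \tau.P \mid [a=b]G \mid G+G'$, well-sorted under a fixed sorting. $\xrightarrow{\mu}$ is the standard early LTS of the asynchronous $\pi$-calculus, actions $\tau$, early inputs $a(\tilde b)$, outputs $(\nu\tilde c)a\langle\tilde b\rangle$ (subject $a$). $\Longrightarrow$ is the reflexive–transitive closure of $\xrightarrow{\tau}$; $\stackrel{\hat\mu}{\Longrightarrow}$ is $\Longrightarrow$ if $\mu=\tau$, else $\Longrightarrow\xrightarrow{\mu}\Longrightarrow$. Ordinary bisimilarity: a relation $\mathcal R$ on processes is a bisimulation if whenever $P\mathcal RQ$ and $P\xrightarrow{\mu}P'$, either $Q\stackrel{\hat\mu}{\Longrightarrow}Q'$ with $P'\mathcal RQ'$, or $\mu=a(\tilde b)$ and $Q|a\langle\tilde b\rangle\Longrightarrow Q'$ with $P'\mathcal RQ'$; and symmetrically for $Q$. $\approx_a$ is the largest bisimulation. Sequentiality: names are partitioned into output-controlled ($x,y,z$) and input-controlled ($u,v,w$). Judgements $\vdash_\eta P$: $\vdash_1 u(\tilde a).P$ if $\vdash_1P$; $\vdash_0 x(\tilde a).P$, $\vdash_0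 !x(\tilde a).P$ if $\vdash_1P$; $\vdash_1x\langle\tilde a\rangle$; $\vdash_0u\langle\tilde a\rangle$; $\vdash_\eta(\nu a)P$ if $\vdash_\eta P$; $\vdash_0\mathbf0$; $\vdash_{\eta_1+\eta_2}P|Q$ if $\vdash_{\eta_1}P$, $\vdash_{\eta_2}Q$, $\eta_1+\eta_2\le1$; $\vdash_\eta G_1+G_2$ if $\vdash_\eta G_1,G_2$; $\vdash_\eta\tau.P$ if $\vdash_\eta P$; $\vdash_0[a=b]G$ if $\vdash_0G$. Type-allowed transition $\eta\vdash P\xrightarrow{\mu}P'$: $\vdash_\eta P$, $P\xrightarrow{\mu}P'$, and $\eta=0$, or $\mu=\tau$, or $\eta=1$ and $\mu$ is an input at an input-controlled name or an output at an output-controlled name. $\langle\eta;P\rangle\xrightarrow{\mu}\langle\eta';P'\rangle$ if $\eta\vdash P\xrightarrow{\mu}P'$ and $\eta'=1$ if $\mu$ is an input at an output-controlled name, $\eta'=0$ if $\mu$ is an output at an output-controlled name, $\eta'=\eta$ otherwise. A sequential bisimulation is a set $\mathcal R$ of triples $(\eta,P,Q)$ with $\vdash_\eta P,Q$ such that whenever $(\eta,P,Q)\in\mathcal R$ and $\langle\eta;P\rangle\xrightarrow{\mu}\langle\eta';P'\rangle$, either $Q\stackrel{\hat\mu}{\Longrightarrow}Q'$ with $(\eta',P',Q')\in\mathcal R$, or $\mu=a(\tilde b)$ and $Q|a\langle\tilde b\rangle\Longrightarrow Q'$ with $(\eta',P',Q')\in\mathcal R$; and symmetrically. $P\approx_s^\eta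 Q$ if $(\eta,P,Q)$ is in some sequential bisimulation. -}

module Defs where

open import Level using (Level)
open import Data.List using (List; []; _∷_; _++_; map; filter; zip; foldr)
open import Data.List.Membership.Propositional using (_∈_; _∉_)
open import Data.List.Relation.Unary.All using (All)
open import Data.List.Relation.Unary.Unique.Propositional using (Unique)
open import Data.Product using (Σ; _×_; _,_; ∃; ∃-syntax; proj₁)
open import Data.Sum using (_⊎_)
open import Relation.Binary.PropositionalEquality using (_≡_; _≢_)
open import Relation.Binary.Definitions using (DecidableEquality)
open import Relation.Nullary using (¬?; yes; no)

data Kind : Set where
  outCtl : Kind
  inCtl  : Kind

record Sorting : Set₁ where
  field
    Sort   : Set
    Name   : Set
    _≟_    : DecidableEquality Name
    sortOf : Name → Sort
    obj    : Sort → List Sort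
    kind   : Sort → Kind
    fresh  : (s : Sort) (ns : List Name) → Σ Name (λ n → sortOf n ≡ s × n ∉ ns)

module Calculus (𝒮 : Sorting) where
  open Sorting 𝒮
  open import Data.List.Membership.DecPropositional _≟_ using (_∈?_)

  kindOf : Name → Kind
  kindOf n = kind (sortOf n)

  data Proc : Set
  data Guard : Set

  data Proc where
    out : Name → List Name → Proc
    rep : Name → List Name → Proc → Proc
    par : Proc → Proc → Proc
    nu  : Name → Proc → Proc
    grd : Guard → Proc

  data Guard where
    nil   : Guard
    inp   : Name → List Name → Proc → Guard
    tau   : Proc → Guard
    match : Name → Name → Guard → Guard
    sum   : Guard → Guard → Guard

  𝟎 : Proc
  𝟎 = grd nil

  nus : List Name → Proc → Proc
  nus ds P = foldr nu P ds

  minus : List Name → List Name → List Name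
  minus xs bs = filter (λ n → ¬? (n ∈? bs)) xs

  fnP : Proc → List Name
  fnG : Guard → List Name
  fnP (out a cs)   = a ∷ cs
  fnP (rep a bs P) = a ∷ minus (fnP P) bs
  fnP (par P Q)    = fnP P ++ fnP Q
  fnP (nu a P)     = minus (fnP P) (a ∷ [])
  fnP (grd G)      = fnG G
  fnG nil           = []
  fnG (inp a bs P)  = a ∷ minus (fnP P) bs
  fnG (tau P)       = fnP P
  fnG (match a b G) = a ∷ b ∷ fnG G
  fnG (sum G H)     = fnG G ++ fnG H

  bnP : Proc → List Name
  bnG : Guard → List Name
  bnP (out a cs)   = []
  bnP (rep a bs P) = bs ++ bnP P
  bnP (par P Q)    = bnP P ++ bnP Q
  bnP (nu a P)     = a ∷ bnP P
  bnP (grd G)      = bnG G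
  bnG nil           = []
  bnG (inp a bs P)  = bs ++ bnP P
  bnG (tau P)       = bnP P
  bnG (match a b G) = bnG G
  bnG (sum G H)     = bnG G ++ bnG H

  allP : Proc → List Name
  allP P = fnP P ++ bnP P

  swapN : Name → Name → Name → Name
  swapN a b n with n ≟ a
  ... | yes _ = b
  ... | no _ with n ≟ b
  ...   | yes _ = a
  ...   | no _ = n

  swapP : Name → Name → Proc → Proc
  swapG : Name → Name → Guard → Guard
  swapP a b (out c cs)   = out (swapN a b c) (map (swapN a b) cs)
  swapP a b (rep c cs P) = rep (swapN a b c) (map (swapN a b) cs) (swapP a b P)
  swapP a b (par P Q)    = par (swapP a b P) (swapP a b Q)
  swapP a b (nu c P)     = nu (swapN a b c) (swapP a b P)
  swapP a b (grd G)      = grd (swapG a b G)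
  swapG a b nil           = nil
  swapG a b (inp c cs P)  = inp (swapN a b c) (map (swapN a b) cs) (swapP a b P)
  swapG a b (tau P)       = tau (swapP a b P)
  swapG a b (match c d G) = match (swapN a b c) (swapN a b d) (swapG a b G)
  swapG a b (sum G H)     = sum (swapG a b G) (swapG a b H)

  swapsP : List Name → List Name → Proc → Proc
  swapsP (b ∷ bs) (c ∷ cs) P = swapsP bs cs (swapP b c P)
  swapsP _ _ P = P

  Subst : Set
  Subst = List (Name × Name)

  appS : Subst → Name → Name
  appS [] n = n
  appS ((b , c) ∷ σ) n with n ≟ b
  ... | yes _ = c
  ... | no _ = appS σ n

  removeS : List Name → Subst → Subst
  removeS bs σ = filter (λ p → ¬? (proj₁ p ∈? bs)) σ

  -- substitution of free occurrences (capture-avoidance is ensured by a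
  -- side condition where it is used)
  subP : Subst → Proc → Proc
  subG : Subst → Guard → Guard
  subP σ (out a cs)   = out (appS σ a) (map (appS σ) cs)
  subP σ (rep a bs P) = rep (appS σ a) bs (subP (removeS bs σ) P)
  subP σ (par P Q)    = par (subP σ P) (subP σ Q)
  subP σ (nu a P)     = nu a (subP (removeS (a ∷ []) σ) P)
  subP σ (grd G)      = grd (subG σ G)
  subG σ nil           = nil
  subG σ (inp a bs P)  = inp (appS σ a) bs (subP (removeS bs σ) P)
  subG σ (tau P)       = tau (subP σ P)
  subG σ (match a b G) = match (appS σ a) (appS σ b) (subG σ G)
  subG σ (sum G H)     = sum (subG σ G) (subG σ H)

  Sorted : Name → List Name → Set
  Sorted a cs = map sortOf cs ≡ obj (sortOf a)

  data WSP : Proc → Set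
  data WSG : Guard → Set
  data WSP where
    out : ∀ {a cs} → Sorted a cs → WSP (out a cs)
    rep : ∀ {a bs P} → Sorted a bs → Unique bs → WSP P → WSP (rep a bs P)
    par : ∀ {P Q} → WSP P → WSP Q → WSP (par P Q)
    nu  : ∀ {a P} → WSP P → WSP (nu a P)
    grd : ∀ {G} → WSG G → WSP (grd G)
  data WSG where
    nil   : WSG nil
    inp   : ∀ {a bs P} → Sorted a bs → Unique bs → WSP P → WSG (inp a bs P)
    tau   : ∀ {P} → WSP P → WSG (tau P)
    match : ∀ {a b G} → WSG G → WSG (match a b G)
    sum   : ∀ {G H} → WSG G → WSG H → WSG (sum G H)

  data _=α_ : Proc → Proc → Set
  data _=αG_ : Guard → Guard → Set
  data _=α_ where
    out : ∀ {a cs} → out a cs =α out a cs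
    rep : ∀ {a bs bs′ P Q} (cs : List Name) →
          Unique cs → map sortOf cs ≡ map sortOf bs → map sortOf cs ≡ map sortOf bs′ →
          All (λ c → c ∉ (bs ++ bs′ ++ allP P ++ allP Q)) cs →
          swapsP bs cs P =α swapsP bs′ cs Q →
          rep a bs P =α rep a bs′ Q
    par : ∀ {P P′ Q Q′} → P =α P′ → Q =α Q′ → par P Q =α par P′ Q′
    nu  : ∀ {a b P Q} (c : Name) →
          sortOf c ≡ sortOf a → sortOf c ≡ sortOf b →
          c ∉ (a ∷ b ∷ allP P ++ allP Q) →
          swapP a c P =α swapP b c Q →
          nu a P =α nu b Q
    grd : ∀ {G H} → G =αG H → grd G =α grd H
  data _=αG_ where
    nil   : nil =αG nil
    inp   : ∀ {a bs bs′ P Q} (cs : List Name) →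
            Unique cs → map sortOf cs ≡ map sortOf bs → map sortOf cs ≡ map sortOf bs′ →
            All (λ c → c ∉ (bs ++ bs′ ++ allP P ++ allP Q)) cs →
            swapsP bs cs P =α swapsP bs′ cs Q →
            inp a bs P =αG inp a bs′ Q
    tau   : ∀ {P Q} → P =α Q → tau P =αG tau Q
    match : ∀ {a b G H} → G =αG H → match a b G =αG match a b H
    sum   : ∀ {G G′ H H′} → G =αG G′ → H =αG H′ → sum G H =αG sum G′ H′

  data Act : Set where
    τ    : Act
    inA  : Name → List Name → Act
    outA : List Name → Name → List Name → Act

  namesA : Act → List Name
  namesA τ             = []
  namesA (inA a cs)    = a ∷ cs
  namesA (outA ds a cs) = a ∷ ds ++ cs

  bnA : Act → List Name
  bnA (outA ds a cs) = ds
  bnA _ = []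

  FreshFor : List Name → List Name → Set
  FreshFor ds ns = All (_∉ ns) ds

  infix 4 _—[_]→_
  data _—[_]→_ : Proc → Act → Proc → Set where
    OUT    : ∀ {a cs} → out a cs —[ outA [] a cs ]→ 𝟎
    INP    : ∀ {a bs P cs} → Sorted a cs → FreshFor cs (bnP P) →
             grd (inp a bs P) —[ inA a cs ]→ subP (zip bs cs) P
    REP    : ∀ {a bs P cs} → Sorted a cs → FreshFor cs (bnP P) →
             rep a bs P —[ inA a cs ]→ par (subP (zip bs cs) P) (rep a bs P)
    TAU    : ∀ {P} → grd (tau P) —[ τ ]→ P
    MATCH  : ∀ {a G μ P′} → grd G —[ μ ]→ P′ → grd (match a a G) —[ μ ]→ P′
    SUML   : ∀ {G H μ P′} → grd G —[ μ ]→ P′ → grd (sum G H) —[ μ ]→ P′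
    SUMR   : ∀ {G H μ P′} → grd H —[ μ ]→ P′ → grd (sum G H) —[ μ ]→ P′
    PARL   : ∀ {P Q μ P′} → P —[ μ ]→ P′ → FreshFor (bnA μ) (fnP Q) →
             par P Q —[ μ ]→ par P′ Q
    PARR   : ∀ {P Q μ Q′} → Q —[ μ ]→ Q′ → FreshFor (bnA μ) (fnP P) →
             par P Q —[ μ ]→ par P Q′
    CLOSEL : ∀ {P Q P′ Q′ ds a cs} → P —[ outA ds a cs ]→ P′ → Q —[ inA a cs ]→ Q′ →
             FreshFor ds (fnP Q) → par P Q —[ τ ]→ nus ds (par P′ Q′)
    CLOSER : ∀ {P Q P′ Q′ ds a cs} → P —[ inA a cs ]→ P′ → Q —[ outA ds a cs ]→ Q′ →
             FreshFor ds (fnP P) → par P Q —[ τ ]→ nus ds (par P′ Q′)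
    RES    : ∀ {a P μ P′} → P —[ μ ]→ P′ → a ∉ namesA μ → nu a P —[ μ ]→ nu a P′
    OPEN   : ∀ {a P P′ ds b cs} → P —[ outA ds b cs ]→ P′ → a ≢ b → a ∈ cs → a ∉ ds →
             nu a P —[ outA (a ∷ ds) b cs ]→ P′
    ALPHA  : ∀ {P P′ μ P″} → P =α P′ → P′ —[ μ ]→ P″ → P —[ μ ]→ P″

  data _≈A_ : Act → Act → Set where
    τ    : τ ≈A τ
    inA  : ∀ {a cs} → inA a cs ≈A inA a cs
    outA : ∀ {ds ds′ a cs} → (∀ {n} → n ∈ ds → n ∈ ds′) → (∀ {n} → n ∈ ds′ → n ∈ ds) →
           outA ds a cs ≈A outA ds′ a cs

  infix 4 _⟹_
  data _⟹_ : Proc → Proc → Set where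
    done : ∀ {P} → P ⟹ P
    step : ∀ {P P′ P″} → P —[ τ ]→ P′ → P′ ⟹ P″ → P ⟹ P″

  WeakHat : Proc → Act → Proc → Set
  WeakHat Q τ Q′ = Q ⟹ Q′
  WeakHat Q μ Q′ =
    Σ Act λ μ′ → Σ Proc λ Q₁ → Σ Proc λ Q₂ →
      Q ⟹ Q₁ × Q₁ —[ μ′ ]→ Q₂ × μ′ ≈A μ × Q₂ ⟹ Q′

  Answer : (Proc → Set) → Proc → Act → Set
  Answer K Q μ =
    (Σ Proc λ Q′ → WeakHat Q μ Q′ × K Q′)
    ⊎ (Σ Name λ a → Σ (List Name) λ cs → μ ≡ inA a cs ×
         (Σ Proc λ Q′ → par Q (out a cs) ⟹ Q′ × K Q′))

  IsBisim : (Proc → Proc → Set) → Set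
  IsBisim R = ∀ {P Q} → R P Q →
      (∀ {μ P′} → P —[ μ ]→ P′ → FreshFor (bnA μ) (fnP Q) → Answer (λ Q′ → R P′ Q′) Q μ)
    × (∀ {μ Q′} → Q —[ μ ]→ Q′ → FreshFor (bnA μ) (fnP P) → Answer (λ P′ → R P′ Q′) P μ)

  _≈ₐ_ : Proc → Proc → Set₁
  P ≈ₐ Q = Σ (Proc → Proc → Set) λ R → IsBisim R × R P Q

  data Eta : Set where
    𝟘 𝟙 : Eta

  data ⊢[_]_ : Eta → Proc → Set
  data ⊢G[_]_ : Eta → Guard → Set
  data ⊢[_]_ where
    out-o : ∀ {x as} → kindOf x ≡ outCtl → ⊢[ 𝟙 ] out x as
    out-i : ∀ {u as} → kindOf u ≡ inCtl → ⊢[ 𝟘 ] out u as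
    rep-o : ∀ {x as P} → kindOf x ≡ outCtl → ⊢[ 𝟙 ] P → ⊢[ 𝟘 ] rep x as P
    nu    : ∀ {η a P} → ⊢[ η ] P → ⊢[ η ] nu a P
    par00 : ∀ {P Q} → ⊢[ 𝟘 ] P → ⊢[ 𝟘 ] Q → ⊢[ 𝟘 ] par P Q
    par10 : ∀ {P Q} → ⊢[ 𝟙 ] P → ⊢[ 𝟘 ] Q → ⊢[ 𝟙 ] par P Q
    par01 : ∀ {P Q} → ⊢[ 𝟘 ] P → ⊢[ 𝟙 ] Q → ⊢[ 𝟙 ] par P Q
    grd   : ∀ {η G} → ⊢G[ η ] G → ⊢[ η ] grd G
  data ⊢G[_]_ where
    inp-i : ∀ {u as P} → kindOf u ≡ inCtl → ⊢[ 𝟙 ] P → ⊢G[ 𝟙 ] inp u as P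
    inp-o : ∀ {x as P} → kindOf x ≡ outCtl → ⊢[ 𝟙 ] P → ⊢G[ 𝟘 ] inp x as P
    nil   : ⊢G[ 𝟘 ] nil
    sum   : ∀ {η G H} → ⊢G[ η ] G → ⊢G[ η ] H → ⊢G[ η ] sum G H
    tau   : ∀ {η P} → ⊢[ η ] P → ⊢G[ η ] tau P
    match : ∀ {a b G} → ⊢G[ 𝟘 ] G → ⊢G[ 𝟘 ] match a b G

  InputAt : Kind → Act → Set
  InputAt k μ = Σ Name λ a → Σ (List Name) λ cs → μ ≡ inA a cs × kindOf a ≡ k

  OutputAt : Kind → Act → Set
  OutputAt k μ = Σ (List Name) λ ds → Σ Name λ a → Σ (List Name) λ cs →
                   μ ≡ outA ds a cs × kindOf a ≡ k

  Allowed : Eta → Act → Set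
  Allowed η μ = η ≡ 𝟘 ⊎ μ ≡ τ ⊎ (η ≡ 𝟙 × (InputAt inCtl μ ⊎ OutputAt outCtl μ))

  TStep : Eta → Proc → Act → Proc → Set
  TStep η P μ P′ = ⊢[ η ] P × P —[ μ ]→ P′ × Allowed η μ

  nextIn : Kind → Eta → Eta
  nextIn outCtl η = 𝟙
  nextIn inCtl  η = η

  nextOut : Kind → Eta → Eta
  nextOut outCtl η = 𝟘
  nextOut inCtl  η = η

  nextη : Eta → Act → Eta
  nextη η τ = η
  nextη η (inA a cs) = nextIn (kindOf a) η
  nextη η (outA ds a cs) = nextOut (kindOf a) η

  CStep : Eta → Proc → Act → Eta → Proc → Set
  CStep η P μ η′ P′ = TStep η P μ P′ × η′ ≡ nextη η μ

  IsSeqBisim : (Eta → Proc → Proc → Set) → Set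
  IsSeqBisim R = ∀ {η P Q} → R η P Q →
      ⊢[ η ] P × ⊢[ η ] Q
    × (∀ {μ η′ P′} → CStep η P μ η′ P′ → FreshFor (bnA μ) (fnP Q) →
         Answer (λ Q′ → R η′ P′ Q′) Q μ)
    × (∀ {μ η′ Q′} → CStep η Q μ η′ Q′ → FreshFor (bnA μ) (fnP P) →
         Answer (λ P′ → R η′ P′ Q′) P μ)

  _≈ₛ[_]_ : Proc → Eta → Proc → Set₁
  P ≈ₛ[ η ] Q = Σ (Eta → Proc → Proc → Set) λ R → IsSeqBisim R × R η P Q

-- The typed restriction of an ordinary bisimulation, {(η, P, Q) | ⊢η P, ⊢η Q, P S Q},
-- is a sequential bisimulation.  Its only non-trivial content is subject reduction:
-- a transition allowed at η leads from a ⊢η process to a ⊢η′ process, η′ being the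
-- updated type.  For parallel composition this is a small case analysis on how η
-- splits between the components, using that a process of type 0 never outputs at
-- an output-controlled name.  Subject reduction in turn needs typing (and sorting)
-- to be invariant under α-conversion and under the sort-respecting substitutions
-- performed by input.
module Submission where

open import Data.Empty using (⊥-elim)
open import Data.List using ([]; _∷_; map; zip)
open import Data.List.Properties using (∷-injectiveˡ; ∷-injectiveʳ; map-∘; map-cong; map-id)
open import Data.List.Relation.Unary.All using (All; []; _∷_)
open import Data.List.Relation.Unary.All.Properties using (filter⁺)
open import Data.Product using (∃₂; _×_; _,_; proj₁; proj₂)
open import Data.Sum using (inj₁; inj₂)
open import Data.Unit using (⊤; tt)
open import Relation.Binary.PropositionalEquality
open import Relation.Nullary using (Dec; yes; no)

open import Defs

module Sequentiality (𝒮 : Sorting) where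
  open Sorting 𝒮
  open Calculus 𝒮

  SortPreserving : (Name → Name) → Set
  SortPreserving f = ∀ n → sortOf (f n) ≡ sortOf n

  kindOf-preserved : ∀ {f n k} → SortPreserving f → kindOf n ≡ k → kindOf (f n) ≡ k
  kindOf-preserved {n = n} p = trans (cong kind (p n))

  Sorted-subject : ∀ {f a cs} → SortPreserving f → Sorted a cs → Sorted (f a) cs
  Sorted-subject {a = a} p s = trans s (cong obj (sym (p a)))

  Sorted-map : ∀ {f a cs} → SortPreserving f → Sorted a cs → Sorted (f a) (map f cs)
  Sorted-map {cs = cs} p s = trans (trans (sym (map-∘ cs)) (map-cong p cs)) (Sorted-subject p s)

  swapN-sortPreserving : ∀ {a b} → sortOf a ≡ sortOf b → SortPreserving (swapN a b)
  swapN-sortPreserving {a} {b} e n with n ≟ a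
  ... | yes refl = sym e
  ... | no _ with n ≟ b
  ...   | yes refl = e
  ...   | no _ = refl

  SortPreservingSubst : Subst → Set
  SortPreservingSubst = All (λ p → sortOf (proj₁ p) ≡ sortOf (proj₂ p))

  appS-sortPreserving : ∀ {σ} → SortPreservingSubst σ → SortPreserving (appS σ)
  appS-sortPreserving [] n = refl
  appS-sortPreserving {(b , c) ∷ σ} (e ∷ es) n with n ≟ b
  ... | yes refl = sym e
  ... | no _ = appS-sortPreserving es n

  removeS-sortPreserving : ∀ bs {σ} → SortPreservingSubst σ → SortPreservingSubst (removeS bs σ)
  removeS-sortPreserving bs = filter⁺ _

  zip-sortPreserving : ∀ bs cs → map sortOf bs ≡ map sortOf cs → SortPreservingSubst (zip bs cs)
  zip-sortPreserving [] cs e = []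
  zip-sortPreserving (b ∷ bs) [] e = []
  zip-sortPreserving (b ∷ bs) (c ∷ cs) e =
    ∷-injectiveˡ e ∷ zip-sortPreserving bs cs (∷-injectiveʳ e)

  swapN-left : ∀ a b → swapN a b a ≡ b
  swapN-left a b with a ≟ a
  ... | yes _ = refl
  ... | no a≢a = ⊥-elim (a≢a refl)

  swapN-right : ∀ a b → swapN a b b ≡ a
  swapN-right a b with b ≟ a
  ... | yes b≡a = b≡a
  ... | no _ with b ≟ b
  ...   | yes _ = refl
  ...   | no b≢b = ⊥-elim (b≢b refl)

  swapN-other : ∀ {a b n} → n ≢ a → n ≢ b → swapN a b n ≡ n
  swapN-other {a} {b} {n} n≢a n≢b with n ≟ a
  ... | yes n≡a = ⊥-elim (n≢a n≡a)
  ... | no _ with n ≟ b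
  ...   | yes n≡b = ⊥-elim (n≢b n≡b)
  ...   | no _ = refl

  swapN-involutive : ∀ a b n → swapN a b (swapN a b n) ≡ n
  swapN-involutive a b n = by-cases (n ≟ a) (n ≟ b)
    where
    open ≡-Reasoning
    by-cases : Dec (n ≡ a) → Dec (n ≡ b) → swapN a b (swapN a b n) ≡ n
    by-cases (yes n≡a) _ = begin
      swapN a b (swapN a b n)  ≡⟨ cong (λ m → swapN a b (swapN a b m)) n≡a ⟩
      swapN a b (swapN a b a)  ≡⟨ cong (swapN a b) (swapN-left a b) ⟩
      swapN a b b              ≡⟨ swapN-right a b ⟩
      a                        ≡⟨ sym n≡a ⟩
      n                        ∎
    by-cases (no _) (yes n≡b) = begin
      swapN a b (swapN a b n)  ≡⟨ cong (λ m → swapN a b (swapN a b m)) n≡b ⟩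
      swapN a b (swapN a b b)  ≡⟨ cong (swapN a b) (swapN-right a b) ⟩
      swapN a b a              ≡⟨ swapN-left a b ⟩
      b                        ≡⟨ sym n≡b ⟩
      n                        ∎
    by-cases (no n≢a) (no n≢b) = begin
      swapN a b (swapN a b n)  ≡⟨ cong (swapN a b) (swapN-other n≢a n≢b) ⟩
      swapN a b n              ≡⟨ swapN-other n≢a n≢b ⟩
      n                        ∎

  map-swapN-involutive : ∀ a b cs → map (swapN a b) (map (swapN a b) cs) ≡ cs
  map-swapN-involutive a b cs =
    trans (sym (map-∘ cs)) (trans (map-cong (swapN-involutive a b) cs) (map-id cs))

  swapP-involutive : ∀ a b P → swapP a b (swapP a b P) ≡ P
  swapG-involutive : ∀ a b G → swapG a b (swapG a b G) ≡ G
  swapP-involutive a b (out c cs)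
    rewrite swapN-involutive a b c | map-swapN-involutive a b cs = refl
  swapP-involutive a b (rep c cs P)
    rewrite swapN-involutive a b c | map-swapN-involutive a b cs | swapP-involutive a b P = refl
  swapP-involutive a b (par P Q)
    rewrite swapP-involutive a b P | swapP-involutive a b Q = refl
  swapP-involutive a b (nu c P)
    rewrite swapN-involutive a b c | swapP-involutive a b P = refl
  swapP-involutive a b (grd G) = cong grd (swapG-involutive a b G)
  swapG-involutive a b nil = refl
  swapG-involutive a b (inp c cs P)
    rewrite swapN-involutive a b c | map-swapN-involutive a b cs | swapP-involutive a b P = refl
  swapG-involutive a b (tau P) = cong tau (swapP-involutive a b P)
  swapG-involutive a b (match c d G)
    rewrite swapN-involutive a b c | swapN-involutive a b d | swapG-involutive a b G = refl
  swapG-involutive a b (sum G H)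
    rewrite swapG-involutive a b G | swapG-involutive a b H = refl

  module SwapInvariant (I : Proc → Set)
      (swap-preserves : ∀ {a b P} → SortPreserving (swapN a b) → I P → I (swapP a b P)) where

    swap-reflects : ∀ {a b} P → sortOf a ≡ sortOf b → I (swapP a b P) → I P
    swap-reflects {a} {b} P e i =
      subst I (swapP-involutive a b P) (swap-preserves (swapN-sortPreserving e) i)

    swaps-preserves : ∀ bs cs {P} → map sortOf bs ≡ map sortOf cs → I P → I (swapsP bs cs P)
    swaps-preserves [] cs e i = i
    swaps-preserves (b ∷ bs) [] e i = i
    swaps-preserves (b ∷ bs) (c ∷ cs) e i =
      swaps-preserves bs cs (∷-injectiveʳ e)
        (swap-preserves (swapN-sortPreserving (∷-injectiveˡ e)) i)

    swaps-reflects : ∀ bs cs P → map sortOf bs ≡ map sortOf cs → I (swapsP bs cs P) → I P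
    swaps-reflects [] cs P e i = i
    swaps-reflects (b ∷ bs) [] P e i = i
    swaps-reflects (b ∷ bs) (c ∷ cs) P e i =
      swap-reflects P (∷-injectiveˡ e) (swaps-reflects bs cs (swapP b c P) (∷-injectiveʳ e) i)

  -- Well-sortedness without distinctness of binders: α-conversion may rename the
  -- binders of a prefix to a repeated name, so WSP itself is not preserved by transitions.
  data RespectsSorts : Proc → Set
  data RespectsSortsG : Guard → Set
  data RespectsSorts where
    out : ∀ {a cs} → RespectsSorts (out a cs)
    rep : ∀ {a bs P} → Sorted a bs → RespectsSorts P → RespectsSorts (rep a bs P)
    par : ∀ {P Q} → RespectsSorts P → RespectsSorts Q → RespectsSorts (par P Q)
    nu  : ∀ {a P} → RespectsSorts P → RespectsSorts (nu a P)
    grd : ∀ {G} → RespectsSortsG G → RespectsSorts (grd G)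
  data RespectsSortsG where
    nil   : RespectsSortsG nil
    inp   : ∀ {a bs P} → Sorted a bs → RespectsSorts P → RespectsSortsG (inp a bs P)
    tau   : ∀ {P} → RespectsSorts P → RespectsSortsG (tau P)
    match : ∀ {a b G} → RespectsSortsG G → RespectsSortsG (match a b G)
    sum   : ∀ {G H} → RespectsSortsG G → RespectsSortsG H → RespectsSortsG (sum G H)

  wsp⇒respectsSorts : ∀ {P} → WSP P → RespectsSorts P
  wsg⇒respectsSortsG : ∀ {G} → WSG G → RespectsSortsG G
  wsp⇒respectsSorts (out _) = out
  wsp⇒respectsSorts (rep s _ p) = rep s (wsp⇒respectsSorts p)
  wsp⇒respectsSorts (par p q) = par (wsp⇒respectsSorts p) (wsp⇒respectsSorts q)
  wsp⇒respectsSorts (nu p) = nu (wsp⇒respectsSorts p)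
  wsp⇒respectsSorts (grd g) = grd (wsg⇒respectsSortsG g)
  wsg⇒respectsSortsG nil = nil
  wsg⇒respectsSortsG (inp s _ p) = inp s (wsp⇒respectsSorts p)
  wsg⇒respectsSortsG (tau p) = tau (wsp⇒respectsSorts p)
  wsg⇒respectsSortsG (match g) = match (wsg⇒respectsSortsG g)
  wsg⇒respectsSortsG (sum g h) = sum (wsg⇒respectsSortsG g) (wsg⇒respectsSortsG h)

  respects-swap : ∀ {a b P} → SortPreserving (swapN a b) →
                  RespectsSorts P → RespectsSorts (swapP a b P)
  respectsG-swap : ∀ {a b G} → SortPreserving (swapN a b) →
                   RespectsSortsG G → RespectsSortsG (swapG a b G)
  respects-swap f out = out
  respects-swap f (rep s p) = rep (Sorted-map f s) (respects-swap f p)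
  respects-swap f (par p q) = par (respects-swap f p) (respects-swap f q)
  respects-swap f (nu p) = nu (respects-swap f p)
  respects-swap f (grd g) = grd (respectsG-swap f g)
  respectsG-swap f nil = nil
  respectsG-swap f (inp s p) = inp (Sorted-map f s) (respects-swap f p)
  respectsG-swap f (tau p) = tau (respects-swap f p)
  respectsG-swap f (match g) = match (respectsG-swap f g)
  respectsG-swap f (sum g h) = sum (respectsG-swap f g) (respectsG-swap f h)

  open SwapInvariant RespectsSorts respects-swap
    renaming (swap-reflects to respects-swap⁻¹; swaps-preserves to respects-swaps;
              swaps-reflects to respects-swaps⁻¹)

  respects-α : ∀ {P Q} → RespectsSorts P → P =α Q → RespectsSorts Q
  respectsG-α : ∀ {G H} → RespectsSortsG G → G =αG H → RespectsSortsG H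
  respects-α p out = p
  respects-α (rep s p) (rep {bs = bs} {bs′} {Q = Q} cs _ e e′ _ α) =
    rep (trans (sym e′) (trans e s))
        (respects-swaps⁻¹ bs′ cs Q (sym e′) (respects-α (respects-swaps bs cs (sym e) p) α))
  respects-α (par p q) (par α β) = par (respects-α p α) (respects-α q β)
  respects-α (nu p) (nu {Q = Q} c e e′ _ α) =
    nu (respects-swap⁻¹ Q (sym e′)
          (respects-α (respects-swap (swapN-sortPreserving (sym e)) p) α))
  respects-α (grd g) (grd α) = grd (respectsG-α g α)
  respectsG-α nil nil = nil
  respectsG-α (inp s p) (inp {bs = bs} {bs′} {Q = Q} cs _ e e′ _ α) =
    inp (trans (sym e′) (trans e s))
        (respects-swaps⁻¹ bs′ cs Q (sym e′) (respects-α (respects-swaps bs cs (sym e) p) α))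
  respectsG-α (tau p) (tau α) = tau (respects-α p α)
  respectsG-α (match g) (match α) = match (respectsG-α g α)
  respectsG-α (sum g h) (sum α β) = sum (respectsG-α g α) (respectsG-α h β)

  respects-subst : ∀ {σ P} → SortPreservingSubst σ → RespectsSorts P → RespectsSorts (subP σ P)
  respectsG-subst : ∀ {σ G} → SortPreservingSubst σ → RespectsSortsG G → RespectsSortsG (subG σ G)
  respects-subst es out = out
  respects-subst es (rep {bs = bs} s p) =
    rep (Sorted-subject (appS-sortPreserving es) s)
        (respects-subst (removeS-sortPreserving bs es) p)
  respects-subst es (par p q) = par (respects-subst es p) (respects-subst es q)
  respects-subst es (nu {a = a} p) = nu (respects-subst (removeS-sortPreserving (a ∷ []) es) p)
  respects-subst es (grd g) = grd (respectsG-subst es g)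
  respectsG-subst es nil = nil
  respectsG-subst es (inp {bs = bs} s p) =
    inp (Sorted-subject (appS-sortPreserving es) s)
        (respects-subst (removeS-sortPreserving bs es) p)
  respectsG-subst es (tau p) = tau (respects-subst es p)
  respectsG-subst es (match g) = match (respectsG-subst es g)
  respectsG-subst es (sum g h) = sum (respectsG-subst es g) (respectsG-subst es h)

  respects-nus : ∀ {P} ds → RespectsSorts P → RespectsSorts (nus ds P)
  respects-nus [] p = p
  respects-nus (d ∷ ds) p = nu (respects-nus ds p)

  respects-step : ∀ {P μ P′} → RespectsSorts P → P —[ μ ]→ P′ → RespectsSorts P′
  respects-step p OUT = grd nil
  respects-step (grd (inp {bs = bs} s p)) (INP {cs = cs} s′ _) =
    respects-subst (zip-sortPreserving bs cs (trans s (sym s′))) p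
  respects-step (rep {bs = bs} s p) (REP {cs = cs} s′ _) =
    par (respects-subst (zip-sortPreserving bs cs (trans s (sym s′))) p) (rep s p)
  respects-step (grd (tau p)) TAU = p
  respects-step (grd (match g)) (MATCH st) = respects-step (grd g) st
  respects-step (grd (sum g h)) (SUML st) = respects-step (grd g) st
  respects-step (grd (sum g h)) (SUMR st) = respects-step (grd h) st
  respects-step (par p q) (PARL st _) = par (respects-step p st) q
  respects-step (par p q) (PARR st _) = par p (respects-step q st)
  respects-step (par p q) (CLOSEL {ds = ds} st st′ _) =
    respects-nus ds (par (respects-step p st) (respects-step q st′))
  respects-step (par p q) (CLOSER {ds = ds} st st′ _) =
    respects-nus ds (par (respects-step p st) (respects-step q st′))
  respects-step (nu p) (RES st _) = nu (respects-step p st)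
  respects-step (nu p) (OPEN st _ _ _) = respects-step p st
  respects-step p (ALPHA α st) = respects-step (respects-α p α) st

  ⊢-swap : ∀ {a b η P} → SortPreserving (swapN a b) → ⊢[ η ] P → ⊢[ η ] swapP a b P
  ⊢G-swap : ∀ {a b η G} → SortPreserving (swapN a b) → ⊢G[ η ] G → ⊢G[ η ] swapG a b G
  ⊢-swap f (out-o k) = out-o (kindOf-preserved f k)
  ⊢-swap f (out-i k) = out-i (kindOf-preserved f k)
  ⊢-swap f (rep-o k t) = rep-o (kindOf-preserved f k) (⊢-swap f t)
  ⊢-swap f (nu t) = nu (⊢-swap f t)
  ⊢-swap f (par00 t u) = par00 (⊢-swap f t) (⊢-swap f u)
  ⊢-swap f (par10 t u) = par10 (⊢-swap f t) (⊢-swap f u)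
  ⊢-swap f (par01 t u) = par01 (⊢-swap f t) (⊢-swap f u)
  ⊢-swap f (grd g) = grd (⊢G-swap f g)
  ⊢G-swap f (inp-i k t) = inp-i (kindOf-preserved f k) (⊢-swap f t)
  ⊢G-swap f (inp-o k t) = inp-o (kindOf-preserved f k) (⊢-swap f t)
  ⊢G-swap f nil = nil
  ⊢G-swap f (sum g h) = sum (⊢G-swap f g) (⊢G-swap f h)
  ⊢G-swap f (tau t) = tau (⊢-swap f t)
  ⊢G-swap f (match g) = match (⊢G-swap f g)

  module ⊢-Swaps {η : Eta} = SwapInvariant ⊢[ η ]_ ⊢-swap
  open ⊢-Swaps renaming (swap-reflects to ⊢-swap⁻¹; swaps-preserves to ⊢-swaps;
                         swaps-reflects to ⊢-swaps⁻¹)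

  ⊢-α : ∀ {η P Q} → ⊢[ η ] P → P =α Q → ⊢[ η ] Q
  ⊢G-α : ∀ {η G H} → ⊢G[ η ] G → G =αG H → ⊢G[ η ] H
  ⊢-α t out = t
  ⊢-α (rep-o k t) (rep {bs = bs} {bs′} {Q = Q} cs _ e e′ _ α) =
    rep-o k (⊢-swaps⁻¹ bs′ cs Q (sym e′) (⊢-α (⊢-swaps bs cs (sym e) t) α))
  ⊢-α (par00 t u) (par α β) = par00 (⊢-α t α) (⊢-α u β)
  ⊢-α (par10 t u) (par α β) = par10 (⊢-α t α) (⊢-α u β)
  ⊢-α (par01 t u) (par α β) = par01 (⊢-α t α) (⊢-α u β)
  ⊢-α (nu t) (nu {Q = Q} c e e′ _ α) =
    nu (⊢-swap⁻¹ Q (sym e′) (⊢-α (⊢-swap (swapN-sortPreserving (sym e)) t) α))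
  ⊢-α (grd g) (grd α) = grd (⊢G-α g α)
  ⊢G-α nil nil = nil
  ⊢G-α (inp-i k t) (inp {bs = bs} {bs′} {Q = Q} cs _ e e′ _ α) =
    inp-i k (⊢-swaps⁻¹ bs′ cs Q (sym e′) (⊢-α (⊢-swaps bs cs (sym e) t) α))
  ⊢G-α (inp-o k t) (inp {bs = bs} {bs′} {Q = Q} cs _ e e′ _ α) =
    inp-o k (⊢-swaps⁻¹ bs′ cs Q (sym e′) (⊢-α (⊢-swaps bs cs (sym e) t) α))
  ⊢G-α (tau t) (tau α) = tau (⊢-α t α)
  ⊢G-α (match g) (match α) = match (⊢G-α g α)
  ⊢G-α (sum g h) (sum α β) = sum (⊢G-α g α) (⊢G-α h β)

  ⊢-subst : ∀ {σ η P} → SortPreservingSubst σ → ⊢[ η ] P → ⊢[ η ] subP σ P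
  ⊢G-subst : ∀ {σ η G} → SortPreservingSubst σ → ⊢G[ η ] G → ⊢G[ η ] subG σ G
  ⊢-subst es (out-o k) = out-o (kindOf-preserved (appS-sortPreserving es) k)
  ⊢-subst es (out-i k) = out-i (kindOf-preserved (appS-sortPreserving es) k)
  ⊢-subst es (rep-o {as = bs} k t) =
    rep-o (kindOf-preserved (appS-sortPreserving es) k) (⊢-subst (removeS-sortPreserving bs es) t)
  ⊢-subst es (nu {a = a} t) = nu (⊢-subst (removeS-sortPreserving (a ∷ []) es) t)
  ⊢-subst es (par00 t u) = par00 (⊢-subst es t) (⊢-subst es u)
  ⊢-subst es (par10 t u) = par10 (⊢-subst es t) (⊢-subst es u)
  ⊢-subst es (par01 t u) = par01 (⊢-subst es t) (⊢-subst es u)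
  ⊢-subst es (grd g) = grd (⊢G-subst es g)
  ⊢G-subst es (inp-i {as = bs} k t) =
    inp-i (kindOf-preserved (appS-sortPreserving es) k) (⊢-subst (removeS-sortPreserving bs es) t)
  ⊢G-subst es (inp-o {as = bs} k t) =
    inp-o (kindOf-preserved (appS-sortPreserving es) k) (⊢-subst (removeS-sortPreserving bs es) t)
  ⊢G-subst es nil = nil
  ⊢G-subst es (sum g h) = sum (⊢G-subst es g) (⊢G-subst es h)
  ⊢G-subst es (tau t) = tau (⊢-subst es t)
  ⊢G-subst es (match g) = match (⊢G-subst es g)

  ⊢-nus : ∀ {η P} ds → ⊢[ η ] P → ⊢[ η ] nus ds P
  ⊢-nus [] t = t
  ⊢-nus (d ∷ ds) t = nu (⊢-nus ds t)

  -- η = η₁ + η₂ ≤ 1, the side condition of the typing rule for P | Q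
  data Split : Eta → Eta → Eta → Set where
    none  : Split 𝟘 𝟘 𝟘
    left  : Split 𝟙 𝟙 𝟘
    right : Split 𝟙 𝟘 𝟙

  split-swap : ∀ {η η₁ η₂} → Split η η₁ η₂ → Split η η₂ η₁
  split-swap none = none
  split-swap left = right
  split-swap right = left

  ⊢-par : ∀ {η η₁ η₂ P Q} → Split η η₁ η₂ → ⊢[ η₁ ] P → ⊢[ η₂ ] Q → ⊢[ η ] par P Q
  ⊢-par none = par00
  ⊢-par left = par10
  ⊢-par right = par01

  ⊢-par⁻¹ : ∀ {η P Q} → ⊢[ η ] par P Q → ∃₂ λ η₁ η₂ → Split η η₁ η₂ × ⊢[ η₁ ] P × ⊢[ η₂ ] Q
  ⊢-par⁻¹ (par00 t u) = _ , _ , none , t , u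
  ⊢-par⁻¹ (par10 t u) = _ , _ , left , t , u
  ⊢-par⁻¹ (par01 t u) = _ , _ , right , t , u

  AdmitsInput : Eta → Kind → Set
  AdmitsInput 𝟘 k = ⊤
  AdmitsInput 𝟙 k = k ≡ inCtl

  AdmitsOutput : Eta → Kind → Set
  AdmitsOutput 𝟘 k = k ≡ inCtl
  AdmitsOutput 𝟙 k = ⊤

  -- Weaker than Allowed: outputs need no condition, they are always admitted (outputs-admitted).
  InputAdmitted : Eta → Act → Set
  InputAdmitted η (inA a cs) = AdmitsInput η (kindOf a)
  InputAdmitted η _ = ⊤

  𝟘-outputs-inputControlled : ∀ {P P′ ds a cs} → ⊢[ 𝟘 ] P → P —[ outA ds a cs ]→ P′ →
                              kindOf a ≡ inCtl
  𝟘-outputs-inputControlled t (ALPHA α st) = 𝟘-outputs-inputControlled (⊢-α t α) st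
  𝟘-outputs-inputControlled (out-i k) OUT = k
  𝟘-outputs-inputControlled (grd (match g)) (MATCH st) = 𝟘-outputs-inputControlled (grd g) st
  𝟘-outputs-inputControlled (grd (sum g h)) (SUML st) = 𝟘-outputs-inputControlled (grd g) st
  𝟘-outputs-inputControlled (grd (sum g h)) (SUMR st) = 𝟘-outputs-inputControlled (grd h) st
  𝟘-outputs-inputControlled (par00 t u) (PARL st _) = 𝟘-outputs-inputControlled t st
  𝟘-outputs-inputControlled (par00 t u) (PARR st _) = 𝟘-outputs-inputControlled u st
  𝟘-outputs-inputControlled (nu t) (RES st _) = 𝟘-outputs-inputControlled t st
  𝟘-outputs-inputControlled (nu t) (OPEN st _ _ _) = 𝟘-outputs-inputControlled t st

  outputs-admitted : ∀ {η P P′ ds a cs} → ⊢[ η ] P → P —[ outA ds a cs ]→ P′ →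
                     AdmitsOutput η (kindOf a)
  outputs-admitted {𝟘} = 𝟘-outputs-inputControlled
  outputs-admitted {𝟙} _ _ = tt

  split-admitsInput : ∀ {η η₁ η₂ k} → Split η η₁ η₂ → AdmitsInput η k → AdmitsInput η₁ k
  split-admitsInput none _ = tt
  split-admitsInput left i = i
  split-admitsInput right _ = tt

  split-inputAdmitted : ∀ {η η₁ η₂} μ → Split η η₁ η₂ → InputAdmitted η μ → InputAdmitted η₁ μ
  split-inputAdmitted τ _ _ = tt
  split-inputAdmitted (inA a cs) sp i = split-admitsInput sp i
  split-inputAdmitted (outA ds a cs) _ _ = tt

  split-nextIn : ∀ {η η₁ η₂} k → Split η η₁ η₂ → AdmitsInput η k →
                 Split (nextIn k η) (nextIn k η₁) η₂
  split-nextIn inCtl sp _ = sp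
  split-nextIn outCtl none _ = left
  split-nextIn outCtl left ()
  split-nextIn outCtl right ()

  split-nextOut : ∀ {η η₁ η₂} k → Split η η₁ η₂ → AdmitsOutput η₁ k →
                  Split (nextOut k η) (nextOut k η₁) η₂
  split-nextOut inCtl sp _ = sp
  split-nextOut outCtl left _ = none
  split-nextOut outCtl none ()
  split-nextOut outCtl right ()

  split-next : ∀ {η η₁ η₂ P μ P′} → Split η η₁ η₂ → ⊢[ η₁ ] P → P —[ μ ]→ P′ →
               InputAdmitted η μ → Split (nextη η μ) (nextη η₁ μ) η₂
  split-next {μ = τ} sp _ _ _ = sp
  split-next {μ = inA a cs} sp _ _ i = split-nextIn (kindOf a) sp i
  split-next {μ = outA ds a cs} sp t st _ = split-nextOut (kindOf a) sp (outputs-admitted t st)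

  split-close : ∀ {η η₁ η₂} k → Split η η₁ η₂ → AdmitsOutput η₁ k →
                Split η (nextOut k η₁) (nextIn k η₂)
  split-close _ none refl = none
  split-close inCtl left _ = left
  split-close outCtl left _ = right
  split-close _ right refl = right

  split-close-admitsInput : ∀ {η η₁ η₂ k} → Split η η₁ η₂ → AdmitsOutput η₁ k → AdmitsInput η₂ k
  split-close-admitsInput none _ = tt
  split-close-admitsInput left _ = tt
  split-close-admitsInput right o = o

  ⊢-inp-continuation : ∀ {η a bs P} → ⊢G[ η ] inp a bs P → ⊢[ 𝟙 ] P
  ⊢-inp-continuation (inp-i _ t) = t
  ⊢-inp-continuation (inp-o _ t) = t

  nextIn-inp : ∀ {η a bs P} → ⊢G[ η ] inp a bs P → 𝟙 ≡ nextIn (kindOf a) η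
  nextIn-inp (inp-i k _) rewrite k = refl
  nextIn-inp (inp-o k _) rewrite k = refl

  ⊢-step : ∀ {η P μ P′} → ⊢[ η ] P → RespectsSorts P → P —[ μ ]→ P′ → InputAdmitted η μ →
           ⊢[ nextη η μ ] P′
  ⊢-step t p (ALPHA α st) i = ⊢-step (⊢-α t α) (respects-α p α) st i
  ⊢-step (out-o k) _ OUT _ rewrite k = grd nil
  ⊢-step (out-i k) _ OUT _ rewrite k = grd nil
  ⊢-step (grd g) (grd (inp {bs = bs} s _)) (INP {cs = cs} s′ _) _ =
    subst (λ η → ⊢[ η ] _) (nextIn-inp g)
      (⊢-subst (zip-sortPreserving bs cs (trans s (sym s′))) (⊢-inp-continuation g))
  ⊢-step (rep-o k t) (rep {bs = bs} s _) (REP {cs = cs} s′ _) _ rewrite k =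
    par10 (⊢-subst (zip-sortPreserving bs cs (trans s (sym s′))) t) (rep-o k t)
  ⊢-step (grd (tau t)) _ TAU _ = t
  ⊢-step (grd (match g)) (grd (match p)) (MATCH st) i = ⊢-step (grd g) (grd p) st i
  ⊢-step (grd (sum g h)) (grd (sum p q)) (SUML st) i = ⊢-step (grd g) (grd p) st i
  ⊢-step (grd (sum g h)) (grd (sum p q)) (SUMR st) i = ⊢-step (grd h) (grd q) st i
  ⊢-step (nu t) (nu p) (RES st _) i = nu (⊢-step t p st i)
  ⊢-step (nu t) (nu p) (OPEN st _ _ _) i = ⊢-step t p st i
  ⊢-step t (par p q) (PARL {μ = μ} st _) i with ⊢-par⁻¹ t
  ... | _ , _ , sp , tP , tQ =
    ⊢-par (split-next sp tP st i) (⊢-step tP p st (split-inputAdmitted μ sp i)) tQ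
  ⊢-step t (par p q) (PARR {μ = μ} st _) i with ⊢-par⁻¹ t
  ... | _ , _ , sp , tP , tQ =
    ⊢-par (split-swap (split-next (split-swap sp) tQ st i)) tP
          (⊢-step tQ q st (split-inputAdmitted μ (split-swap sp) i))
  ⊢-step t (par p q) (CLOSEL {ds = ds} {a = a} st st′ _) _ with ⊢-par⁻¹ t
  ... | _ , _ , sp , tP , tQ =
    ⊢-nus ds (⊢-par (split-close (kindOf a) sp o) (⊢-step tP p st tt)
                    (⊢-step tQ q st′ (split-close-admitsInput sp o)))
    where o = outputs-admitted tP st
  ⊢-step t (par p q) (CLOSER {ds = ds} {a = a} st st′ _) _ with ⊢-par⁻¹ t
  ... | _ , _ , sp , tP , tQ =
    ⊢-nus ds (⊢-par (split-swap (split-close (kindOf a) (split-swap sp) o))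
                    (⊢-step tP p st (split-close-admitsInput (split-swap sp) o))
                    (⊢-step tQ q st′ tt))
    where o = outputs-admitted tQ st′

  Typed : Eta → Proc → Set
  Typed η P = ⊢[ η ] P × RespectsSorts P

  typed-step : ∀ {η P μ P′} → Typed η P → P —[ μ ]→ P′ → InputAdmitted η μ →
               Typed (nextη η μ) P′
  typed-step (t , p) st i = ⊢-step t p st i , respects-step p st

  typed-⟹ : ∀ {η P P′} → Typed η P → P ⟹ P′ → Typed η P′
  typed-⟹ tp done = tp
  typed-⟹ tp (step st w) = typed-⟹ (typed-step tp st tt) w

  typed-≈A-step : ∀ {η P μ μ′ P′} → Typed η P → P —[ μ′ ]→ P′ → μ′ ≈A μ →
                  InputAdmitted η μ → Typed (nextη η μ) P′
  typed-≈A-step tp st τ i = typed-step tp st i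
  typed-≈A-step tp st inA i = typed-step tp st i
  typed-≈A-step tp st (outA _ _) i = typed-step tp st i

  typed-weakHat : ∀ {η Q Q′} μ → Typed η Q → InputAdmitted η μ → WeakHat Q μ Q′ →
                  Typed (nextη η μ) Q′
  typed-weakHat τ tq _ w = typed-⟹ tq w
  typed-weakHat (inA _ _) tq i (_ , _ , _ , w , st , e , w′) =
    typed-⟹ (typed-≈A-step (typed-⟹ tq w) st e i) w′
  typed-weakHat (outA _ _ _) tq i (_ , _ , _ , w , st , e , w′) =
    typed-⟹ (typed-≈A-step (typed-⟹ tq w) st e i) w′

  ⊢-par-out : ∀ η {Q a cs} → ⊢[ η ] Q → AdmitsInput η (kindOf a) →
              ⊢[ nextIn (kindOf a) η ] par Q (out a cs)
  ⊢-par-out η {a = a} t i with kindOf a in k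
  ⊢-par-out 𝟘 t _ | outCtl = par01 t (out-o k)
  ⊢-par-out 𝟘 t _ | inCtl = par00 t (out-i k)
  ⊢-par-out 𝟙 t _ | inCtl = par10 t (out-i k)
  ⊢-par-out 𝟙 t () | outCtl

  answer-typed : ∀ {η μ Q} {K K′ : Proc → Set} → Typed η Q → InputAdmitted η μ →
                 (∀ {Q′} → Typed (nextη η μ) Q′ → K Q′ → K′ Q′) → Answer K Q μ → Answer K′ Q μ
  answer-typed {μ = μ} tq i f (inj₁ (Q′ , w , k)) = inj₁ (Q′ , w , f (typed-weakHat μ tq i w) k)
  answer-typed {η} tq i f (inj₂ (a , cs , refl , Q′ , w , k)) =
    inj₂ (a , cs , refl , Q′ , w , f (typed-⟹ (⊢-par-out η (proj₁ tq) i , par (proj₂ tq) out) w) k)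

  allowed⇒inputAdmitted : ∀ η μ → Allowed η μ → InputAdmitted η μ
  allowed⇒inputAdmitted _ τ _ = tt
  allowed⇒inputAdmitted _ (outA _ _ _) _ = tt
  allowed⇒inputAdmitted 𝟘 (inA _ _) _ = tt
  allowed⇒inputAdmitted 𝟙 (inA _ _) (inj₁ ())
  allowed⇒inputAdmitted 𝟙 (inA _ _) (inj₂ (inj₁ ()))
  allowed⇒inputAdmitted 𝟙 (inA _ _) (inj₂ (inj₂ (_ , inj₁ (_ , _ , refl , k)))) = k
  allowed⇒inputAdmitted 𝟙 (inA _ _) (inj₂ (inj₂ (_ , inj₂ (_ , _ , _ , () , _))))

  TypedRestriction : (Proc → Proc → Set) → Eta → Proc → Proc → Set
  TypedRestriction S η P Q = Typed η P × Typed η Q × S P Q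

  typedRestriction-isSeqBisim : ∀ {S} → IsBisim S → IsSeqBisim (TypedRestriction S)
  typedRestriction-isSeqBisim isBisim {η} (tP , tQ , s) =
      proj₁ tP , proj₁ tQ
    , (λ { {μ} ((_ , st , al) , refl) fr →
           let i = allowed⇒inputAdmitted η μ al in
           answer-typed tQ i (λ tQ′ k → typed-step tP st i , tQ′ , k) (proj₁ (isBisim s) st fr) })
    , (λ { {μ} ((_ , st , al) , refl) fr →
           let i = allowed⇒inputAdmitted η μ al in
           answer-typed tP i (λ tP′ k → tP′ , typed-step tQ st i , k) (proj₂ (isBisim s) st fr) })

mainTheorem7 : (𝒮 : Sorting) → let open Calculus 𝒮 in
    (η : Eta) (P Q : Proc) → WSP P → WSP Q → ⊢[ η ] P → ⊢[ η ] Q →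
    P ≈ₐ Q → P ≈ₛ[ η ] Q
mainTheorem7 𝒮 η P Q wP wQ tP tQ (S , isBisim , PSQ) =
    TypedRestriction S
  , typedRestriction-isSeqBisim isBisim
  , (tP , wsp⇒respectsSorts wP) , (tQ , wsp⇒respectsSorts wQ) , PSQ
  where open Sequentiality 𝒮
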